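{- Let $d\geq 1$ be an integer. Let $n$ and $m$ be integers with $\binom{d}{2}\leq m\leq dn-\binom{d+1}{2}$ and such that $m \bmod d = 0$ if $d$ is odd and $m\bmod d=\frac{d}{2}$ if $d$ is even. Then there is a $d$-degenerate graph $G$ with $n$ vertices and $m$ edges with exactly \[n+\frac{(2^d-1)m}{d}-\frac{(d-3)2^d+d+1}{2}\] cliques.
   Context: All graphs are finite, simple and undirected. A graph is $d$-degenerate if every subgraph of it has a vertex of degree at most $d$. A clique is a (possibly empty) set of pairwise adjacent vertices; the number of cliques counts $\emptyset$ and single vertices. -}

module Defs where

open import Data.Bool using (Bool; true; false; T; _∧_; _∨_; not; if_then_else_)
open import Data.Nat using (ℕ; zero; suc; _+_; _≤_; _<ᵇ_)
open import Data.Fin using (Fin; toℕ)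
open import Data.Fin.Subset using (Subset; _∈_; Nonempty)
open import Data.List using (List; []; _∷_; _++_; map; allFin; concatMap)
open import Data.Bool.ListAction using (any)
open import Data.Vec using (Vec; []; _∷_; lookup)
open import Data.Product using (_×_; ∃)
open import Relation.Binary.PropositionalEquality using (_≡_)

record Graph (n : ℕ) : Set where
  field
    adj   : Fin n → Fin n → Bool
    sym   : ∀ i j → adj i j ≡ adj j i
    irrefl : ∀ i → adj i i ≡ false
open Graph public

count : {A : Set} → (A → Bool) → List A → ℕ
count p [] = 0
count p (x ∷ xs) = if p x then suc (count p xs) else count p xs

allPairs : (n : ℕ) → List (Fin n × Fin n)
allPairs n = concatMap (λ i → map (λ j → i Data.Product., j) (allFin n)) (allFin n)

edgeCount : {n : ℕ} → Graph n → ℕ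
edgeCount {n} G = count (λ { (i Data.Product., j) → (toℕ i <ᵇ toℕ j) ∧ adj G i j }) (allPairs n)

degree : {n : ℕ} → Graph n → Fin n → ℕ
degree {n} G v = count (adj G v) (allFin n)

allSubsets : (n : ℕ) → List (Subset n)
allSubsets zero = [] ∷ []
allSubsets (suc n) = map (true ∷_) (allSubsets n) ++ map (false ∷_) (allSubsets n)

isClique : {n : ℕ} → Graph n → Subset n → Bool
isClique {n} G S =
  not (any (λ { (i Data.Product., j) →
         (toℕ i <ᵇ toℕ j) ∧ lookup S i ∧ lookup S j ∧ not (adj G i j) }) (allPairs n))

-- number of cliques (including the empty set and singletons)
cliqueCount : {n : ℕ} → Graph n → ℕ
cliqueCount {n} G = count (isClique G) (allSubsets n)

IsSubgraphOn : {n : ℕ} → Graph n → Subset n → Graph n → Set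
IsSubgraphOn G S H = ∀ i j → T (adj H i j) → (i ∈ S) × (j ∈ S) × T (adj G i j)

Degenerate : {n : ℕ} → ℕ → Graph n → Set
Degenerate {n} d G =
  ∀ (S : Subset n) → Nonempty S → ∀ (H : Graph n) → IsSubgraphOn G S H →
    ∃ λ v → (v ∈ S) × degree H v ≤ d

{-# OPTIONS --safe #-}
-- The graph is the complete split graph on a d-clique and an independent set of
-- k vertices (every clique vertex adjacent to every independent vertex), plus r
-- isolated vertices.  The congruence hypotheses say exactly that m ≡ C(d,2)
-- (mod d), so m = k·d + C(d,2) for some k ≥ 0, and the upper bound on m says
-- that n − k − d = r ≥ 0.  Adding the vertices one at a time, each new vertex
-- has at most d earlier neighbours, which gives d-degeneracy.  A clique
-- containing a new vertex is a clique of the earlier graph inside its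
-- neighbourhood; hence the cliques are the 2^d subsets of the d-clique, the
-- k·2^d such subsets together with one independent vertex, and the r isolated
-- singletons: (k+1)·2^d + r in total, which is the stated formula.
module Submission where

open import Defs hiding (sym)
open import Data.Nat using (ℕ; suc; _+_; _*_; _^_; _∸_; _≤_; NonZero)
open import Data.Nat.DivMod using (_%_; _/_)
open import Data.Nat.Combinatorics using (_C_)
open import Data.Integer using (ℤ; +_; _-_)
open import Data.Product using (Σ; _×_)
open import Relation.Binary.PropositionalEquality using (_≡_)

open import Algebra.Bundles using (CommutativeMonoid)
open import Data.Bool using (Bool; true; false; T; _∧_; not; if_then_else_)
open import Data.Bool.ListAction using (any)
open import Data.Bool.Properties using (∧-assoc; ∧-identityʳ; ∧-commutativeMonoid; not-involutive)
open import Data.Empty using (⊥-elim-irr)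
open import Data.Fin using (Fin; zero; suc; toℕ)
open import Data.Fin.Subset using (Subset)
import Data.Integer as ℤ
open import Data.Integer.Properties using (pos-+; pos-*)
import Data.Integer.Tactic.RingSolver as ℤ-Solver
open import Data.List using (List; []; _∷_; _++_; map; concat; tabulate; allFin)
open import Data.List.Properties using (map-tabulate)
open import Data.Nat using (zero; _<_; _<ᵇ_; _≡ᵇ_; z≤n; s≤s)
open import Data.Nat.Combinatorics using (nCk+nC[k+1]≡[n+1]C[k+1]; nC1≡n)
open import Data.Nat.DivMod
  using (m≡m%n+[m/n]*n; m%n<n; m*n%n≡0; [m+kn]%n≡m%n; m<n⇒m%n≡m; /-monoˡ-≤)
open import Data.Nat.Properties
  using (+-0-monoid; +-assoc; +-identityʳ; +-cancelʳ-≡; *-cancelˡ-≡; *-cancelˡ-≤;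
         ≤-reflexive; ≤-trans; n≤1+n; m≤n⇒m≤1+n; m∸n+n≡m; m<m*n; m^n>0)
open import Data.Nat.Tactic.RingSolver using (solve-∀)
open import Data.Product using (_,_; proj₂; ∃-syntax)
open import Data.Sum using (_⊎_; inj₁; inj₂)
open import Data.Unit using (tt)
open import Data.Vec using (_∷_; []; lookup; here; there)
open import Function using (_∘_)
open import Relation.Binary.PropositionalEquality
  using (refl; sym; trans; cong; cong₂; subst; _≗_; module ≡-Reasoning)

open import Algebra.Properties.CommutativeSemigroup (CommutativeMonoid.commutativeSemigroup ∧-commutativeMonoid)
  using (interchange)
open import Algebra.Properties.Monoid.Sum +-0-monoid using (sum; sum-cong-≗)

open ≡-Reasoning

countFin : ∀ {n} → (Fin n → Bool) → ℕ
countFin p = sum (λ i → if p i then 1 else 0)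

countFin-false : ∀ n → countFin {n} (λ _ → false) ≡ 0
countFin-false zero = refl
countFin-false (suc n) = countFin-false n

countFin-true : ∀ n → countFin {n} (λ _ → true) ≡ n
countFin-true zero = refl
countFin-true (suc n) = cong suc (countFin-true n)

countFin-mono : ∀ {n} {p q : Fin n → Bool} → (∀ i → T (p i) → T (q i)) → countFin p ≤ countFin q
countFin-mono {zero} p⇒q = z≤n
countFin-mono {suc n} {p} {q} p⇒q with p zero in p₀ | q zero in q₀
... | true  | true  = s≤s (countFin-mono (p⇒q ∘ suc))
... | false | true  = m≤n⇒m≤1+n (countFin-mono (p⇒q ∘ suc))
... | false | false = countFin-mono (p⇒q ∘ suc)
... | true  | false with () ← subst T q₀ (p⇒q zero (subst T (sym p₀) tt))

module _ {A : Set} where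

  count-cong : {p q : A → Bool} → p ≗ q → count p ≗ count q
  count-cong p≗q [] = refl
  count-cong {p} {q} p≗q (x ∷ xs) rewrite p≗q x with q x
  ... | true  = cong suc (count-cong p≗q xs)
  ... | false = count-cong p≗q xs

  count-false : count {A} (λ _ → false) ≗ λ _ → 0
  count-false [] = refl
  count-false (x ∷ xs) = count-false xs

  count-∧ : ∀ b (p : A → Bool) xs → count (λ x → b ∧ p x) xs ≡ (if b then count p xs else 0)
  count-∧ true p xs = refl
  count-∧ false p xs = count-false xs

  count-++ : ∀ (p : A → Bool) xs ys → count p (xs ++ ys) ≡ count p xs + count p ys
  count-++ p [] ys = refl
  count-++ p (x ∷ xs) ys with p x
  ... | true  = cong suc (count-++ p xs ys)
  ... | false = count-++ p xs ys

  count-tabulate : ∀ {n} (p : A → Bool) (f : Fin n → A) → count p (tabulate f) ≡ countFin (p ∘ f)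
  count-tabulate {zero} p f = refl
  count-tabulate {suc n} p f with p (f zero)
  ... | true  = cong suc (count-tabulate p (f ∘ suc))
  ... | false = count-tabulate p (f ∘ suc)

  count-concat-tabulate : ∀ {n} (p : A → Bool) (f : Fin n → List A) →
    count p (concat (tabulate f)) ≡ sum (λ i → count p (f i))
  count-concat-tabulate {zero} p f = refl
  count-concat-tabulate {suc n} p f =
    trans (count-++ p (f zero) _) (cong (_+_ (count p (f zero))) (count-concat-tabulate p (f ∘ suc)))

  any-as-count : ∀ (p : A → Bool) xs → any p xs ≡ not (count p xs ≡ᵇ 0)
  any-as-count p [] = refl
  any-as-count p (x ∷ xs) with p x
  ... | true  = refl
  ... | false = any-as-count p xs

module _ {A B : Set} where

  count-map : ∀ (p : B → Bool) (f : A → B) → count p ∘ map f ≗ count (p ∘ f)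
  count-map p f [] = refl
  count-map p f (x ∷ xs) with p (f x)
  ... | true  = cong suc (count-map p f xs)
  ... | false = count-map p f xs

count-allFin : ∀ {n} (p : Fin n → Bool) → count p (allFin n) ≡ countFin p
count-allFin p = count-tabulate p (λ i → i)

count-allPairs : ∀ {n} (p : Fin n × Fin n → Bool) →
  count p (allPairs n) ≡ sum (λ i → countFin (λ j → p (i , j)))
count-allPairs {n} p = begin
  count p (concat (map row (allFin n)))  ≡⟨ cong (count p ∘ concat) (map-tabulate (λ i → i) row) ⟩
  count p (concat (tabulate row))        ≡⟨ count-concat-tabulate p row ⟩
  sum (λ i → count p (row i))            ≡⟨ sum-cong-≗ row-count ⟩
  sum (λ i → countFin (λ j → p (i , j))) ∎
  where
  row : Fin n → List (Fin n × Fin n)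
  row i = map (i ,_) (allFin n)
  row-count : ∀ i → count p (row i) ≡ countFin (λ j → p (i , j))
  row-count i = trans (count-map p (i ,_) (allFin n)) (count-allFin (λ j → p (i , j)))

count-allSubsets : ∀ {n} (p : Subset (suc n) → Bool) →
  count p (allSubsets (suc n)) ≡ count (p ∘ (true ∷_)) (allSubsets n) + count (p ∘ (false ∷_)) (allSubsets n)
count-allSubsets {n} p =
  trans (count-++ p (map (true ∷_) (allSubsets n)) _)
        (cong₂ _+_ (count-map p (true ∷_) (allSubsets n)) (count-map p (false ∷_) (allSubsets n)))

+-≡ᵇ0 : ∀ m n → (m + n ≡ᵇ 0) ≡ (m ≡ᵇ 0) ∧ (n ≡ᵇ 0)
+-≡ᵇ0 zero n = refl
+-≡ᵇ0 (suc m) n = refl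

-- Removing and adding vertex zero

tailGraph : ∀ {n} → Graph (suc n) → Graph n
tailGraph G = record
  { adj = λ i j → adj G (suc i) (suc j)
  ; sym = λ i j → Graph.sym G (suc i) (suc j)
  ; irrefl = λ i → irrefl G (suc i)
  }

firstNeighbours : ∀ {n} → Graph (suc n) → Fin n → Bool
firstNeighbours G j = adj G zero (suc j)

module _ {n} (G : Graph n) (N : Fin n → Bool) where

  private
    adj⁺ : Fin (suc n) → Fin (suc n) → Bool
    adj⁺ zero zero = false
    adj⁺ zero (suc j) = N j
    adj⁺ (suc i) zero = N i
    adj⁺ (suc i) (suc j) = adj G i j

    sym⁺ : ∀ i j → adj⁺ i j ≡ adj⁺ j i
    sym⁺ zero zero = refl
    sym⁺ zero (suc j) = refl
    sym⁺ (suc i) zero = refl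
    sym⁺ (suc i) (suc j) = Graph.sym G i j

    irrefl⁺ : ∀ i → adj⁺ i i ≡ false
    irrefl⁺ zero = refl
    irrefl⁺ (suc i) = irrefl G i

  -- The new vertex is zero, the old vertex i becomes suc i; so that
  -- tailGraph (extend G N) = G and firstNeighbours (extend G N) = N hold definitionally.
  extend : Graph (suc n)
  extend = record { adj = adj⁺ ; sym = sym⁺ ; irrefl = irrefl⁺ }

edgeCount-as-sum : ∀ {n} (G : Graph n) →
  edgeCount G ≡ sum (λ i → countFin (λ j → (toℕ i <ᵇ toℕ j) ∧ adj G i j))
edgeCount-as-sum {n} G = count-allPairs {n} _

edgeCount-suc : ∀ {n} (G : Graph (suc n)) →
  edgeCount G ≡ countFin (firstNeighbours G) + edgeCount (tailGraph G)
edgeCount-suc G =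
  trans (edgeCount-as-sum G) (cong (_+_ (countFin (firstNeighbours G))) (sym (edgeCount-as-sum (tailGraph G))))

-- Degeneracy

degree-zero : ∀ {n} (H : Graph (suc n)) → degree H zero ≡ countFin (firstNeighbours H)
degree-zero H = begin
  degree H zero
    ≡⟨ count-allFin (adj H zero) ⟩
  (if adj H zero zero then 1 else 0) + countFin (firstNeighbours H)
    ≡⟨ cong (λ b → (if b then 1 else 0) + countFin (firstNeighbours H)) (irrefl H zero) ⟩
  countFin (firstNeighbours H)
    ∎

degree-suc : ∀ {n} (H : Graph (suc n)) v → adj H (suc v) zero ≡ false → degree H (suc v) ≡ degree (tailGraph H) v
degree-suc H v no-edge = begin
  degree H (suc v)
    ≡⟨ count-allFin (adj H (suc v)) ⟩
  (if adj H (suc v) zero then 1 else 0) + countFin (adj (tailGraph H) v)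
    ≡⟨ cong (λ b → (if b then 1 else 0) + countFin (adj (tailGraph H) v)) no-edge ⟩
  countFin (adj (tailGraph H) v)
    ≡⟨ sym (count-allFin (adj (tailGraph H) v)) ⟩
  degree (tailGraph H) v
    ∎

IsSubgraphOn-tail : ∀ {n} {G H : Graph (suc n)} {b S} →
  IsSubgraphOn G (b ∷ S) H → IsSubgraphOn (tailGraph G) S (tailGraph H)
IsSubgraphOn-tail H⊆G i j e with H⊆G (suc i) (suc j) e
... | there i∈S , there j∈S , e∈G = i∈S , j∈S , e∈G

IsSubgraphOn-outside : ∀ {n} {G H : Graph (suc n)} {S} →
  IsSubgraphOn G (false ∷ S) H → ∀ v → adj H (suc v) zero ≡ false
IsSubgraphOn-outside {H = H} H⊆G v with adj H (suc v) zero in e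
... | false = refl
... | true with _ , () , _ ← H⊆G (suc v) zero (subst T (sym e) tt)

degenerate-empty : ∀ d (G : Graph 0) → Degenerate d G
degenerate-empty d G S (() , _)

-- A subgraph containing vertex zero has it as a vertex of degree ≤ d;
-- any other subgraph lives on the tail.
degenerate-suc : ∀ {n d} (G : Graph (suc n)) →
  Degenerate d (tailGraph G) → countFin (firstNeighbours G) ≤ d → Degenerate d G
degenerate-suc G tail-degenerate first≤d (true ∷ S) _ H H⊆G =
  zero , here , ≤-trans (≤-reflexive (degree-zero H)) (≤-trans H-first≤G-first first≤d)
  where
  H-first≤G-first : countFin (firstNeighbours H) ≤ countFin (firstNeighbours G)
  H-first≤G-first = countFin-mono (λ j e → proj₂ (proj₂ (H⊆G zero (suc j) e)))
degenerate-suc G tail-degenerate first≤d (false ∷ S) (suc i , there i∈S) H H⊆G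
  with v , v∈S , deg≤d ← tail-degenerate S (i , i∈S) (tailGraph H) (IsSubgraphOn-tail {G = G} {H} H⊆G)
  = suc v , there v∈S , subst (_≤ _) (sym (degree-suc H v (IsSubgraphOn-outside {G = G} {H} H⊆G v))) deg≤d

-- Cliques

infix 7 _⊆ᵇ_

_⊆ᵇ_ : ∀ {n} → Subset n → (Fin n → Bool) → Bool
[] ⊆ᵇ M = true
(true ∷ S) ⊆ᵇ M = M zero ∧ S ⊆ᵇ (M ∘ suc)
(false ∷ S) ⊆ᵇ M = S ⊆ᵇ (M ∘ suc)

⊆ᵇ-cong : ∀ {n} (S : Subset n) {M M′ : Fin n → Bool} → M ≗ M′ → S ⊆ᵇ M ≡ S ⊆ᵇ M′
⊆ᵇ-cong [] M≗M′ = refl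
⊆ᵇ-cong (true ∷ S) M≗M′ = cong₂ _∧_ (M≗M′ zero) (⊆ᵇ-cong S (M≗M′ ∘ suc))
⊆ᵇ-cong (false ∷ S) M≗M′ = ⊆ᵇ-cong S (M≗M′ ∘ suc)

⊆ᵇ-all : ∀ {n} (S : Subset n) → S ⊆ᵇ (λ _ → true) ≡ true
⊆ᵇ-all [] = refl
⊆ᵇ-all (true ∷ S) = ⊆ᵇ-all S
⊆ᵇ-all (false ∷ S) = ⊆ᵇ-all S

⊆ᵇ-∧ : ∀ {n} (S : Subset n) (M N : Fin n → Bool) → S ⊆ᵇ (λ j → M j ∧ N j) ≡ S ⊆ᵇ M ∧ S ⊆ᵇ N
⊆ᵇ-∧ [] M N = refl
⊆ᵇ-∧ (true ∷ S) M N = trans (cong ((M zero ∧ N zero) ∧_) (⊆ᵇ-∧ S (M ∘ suc) (N ∘ suc)))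
                            (interchange (M zero) (N zero) _ _)
⊆ᵇ-∧ (false ∷ S) M N = ⊆ᵇ-∧ S (M ∘ suc) (N ∘ suc)

⊆ᵇ-as-count : ∀ {n} (S : Subset n) (M : Fin n → Bool) →
  (countFin (λ j → lookup S j ∧ not (M j)) ≡ᵇ 0) ≡ S ⊆ᵇ M
⊆ᵇ-as-count [] M = refl
⊆ᵇ-as-count (true ∷ S) M =
  trans (+-≡ᵇ0 (if not (M zero) then 1 else 0) _)
        (cong₂ _∧_ (outside-zero (M zero)) (⊆ᵇ-as-count S (M ∘ suc)))
  where
  outside-zero : ∀ b → ((if not b then 1 else 0) ≡ᵇ 0) ≡ b
  outside-zero true = refl
  outside-zero false = refl
⊆ᵇ-as-count (false ∷ S) M = ⊆ᵇ-as-count S (M ∘ suc)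

nonEdgesWithin : ∀ {n} → Graph n → Subset n → ℕ
nonEdgesWithin {n} G S =
  sum (λ i → countFin (λ j → (toℕ i <ᵇ toℕ j) ∧ lookup S i ∧ lookup S j ∧ not (adj G i j)))

isClique-as-nonEdges : ∀ {n} (G : Graph n) S → isClique G S ≡ (nonEdgesWithin G S ≡ᵇ 0)
isClique-as-nonEdges {n} G S =
  trans (cong not (any-as-count _ (allPairs n))) (trans (not-involutive _) (cong (_≡ᵇ 0) (count-allPairs {n} _)))

isClique-true∷ : ∀ {n} (G : Graph (suc n)) S →
  isClique G (true ∷ S) ≡ S ⊆ᵇ firstNeighbours G ∧ isClique (tailGraph G) S
isClique-true∷ G S = begin
  isClique G (true ∷ S)
    ≡⟨ isClique-as-nonEdges G (true ∷ S) ⟩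
  (countFin (λ j → lookup S j ∧ not (firstNeighbours G j)) + nonEdgesWithin (tailGraph G) S ≡ᵇ 0)
    ≡⟨ +-≡ᵇ0 (countFin (λ j → lookup S j ∧ not (firstNeighbours G j))) (nonEdgesWithin (tailGraph G) S) ⟩
  (countFin (λ j → lookup S j ∧ not (firstNeighbours G j)) ≡ᵇ 0) ∧ (nonEdgesWithin (tailGraph G) S ≡ᵇ 0)
    ≡⟨ cong₂ _∧_ (⊆ᵇ-as-count S (firstNeighbours G)) (sym (isClique-as-nonEdges (tailGraph G) S)) ⟩
  S ⊆ᵇ firstNeighbours G ∧ isClique (tailGraph G) S
    ∎

isClique-false∷ : ∀ {n} (G : Graph (suc n)) S → isClique G (false ∷ S) ≡ isClique (tailGraph G) S
isClique-false∷ {n} G S = begin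
  isClique G (false ∷ S)
    ≡⟨ isClique-as-nonEdges G (false ∷ S) ⟩
  (countFin {n} (λ _ → false) + nonEdgesWithin (tailGraph G) S ≡ᵇ 0)
    ≡⟨ cong (λ k → k + nonEdgesWithin (tailGraph G) S ≡ᵇ 0) (countFin-false n) ⟩
  (nonEdgesWithin (tailGraph G) S ≡ᵇ 0)
    ≡⟨ sym (isClique-as-nonEdges (tailGraph G) S) ⟩
  isClique (tailGraph G) S
    ∎

cliquesWithin : ∀ {n} → Graph n → (Fin n → Bool) → ℕ
cliquesWithin {n} G M = count (λ S → S ⊆ᵇ M ∧ isClique G S) (allSubsets n)

cliquesWithin-cong : ∀ {n} (G : Graph n) {M M′ : Fin n → Bool} →
  M ≗ M′ → cliquesWithin G M ≡ cliquesWithin G M′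
cliquesWithin-cong {n} G M≗M′ = count-cong (λ S → cong (_∧ isClique G S) (⊆ᵇ-cong S M≗M′)) (allSubsets n)

cliqueCount-as-cliquesWithin : ∀ {n} (G : Graph n) → cliqueCount G ≡ cliquesWithin G (λ _ → true)
cliqueCount-as-cliquesWithin {n} G = count-cong (λ S → cong (_∧ isClique G S) (sym (⊆ᵇ-all S))) (allSubsets n)

-- A clique containing vertex zero is a clique of the tail inside the neighbourhood of zero.
cliquesWithin-suc : ∀ {n} (G : Graph (suc n)) (M : Fin (suc n) → Bool) →
  cliquesWithin G M ≡
    (if M zero then cliquesWithin (tailGraph G) (λ j → M (suc j) ∧ firstNeighbours G j) else 0)
    + cliquesWithin (tailGraph G) (M ∘ suc)
cliquesWithin-suc {n} G M = trans (count-allSubsets {n} _) (cong₂ _+_ with-zero without-zero)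
  where
  G⁻ : Graph n
  G⁻ = tailGraph G
  N : Fin n → Bool
  N = firstNeighbours G
  with-zero : count (λ S → (true ∷ S) ⊆ᵇ M ∧ isClique G (true ∷ S)) (allSubsets n)
            ≡ (if M zero then cliquesWithin G⁻ (λ j → M (suc j) ∧ N j) else 0)
  with-zero = trans (count-cong reorder (allSubsets n)) (count-∧ (M zero) _ (allSubsets n))
    where
    reorder : ∀ S → (true ∷ S) ⊆ᵇ M ∧ isClique G (true ∷ S)
                  ≡ M zero ∧ (S ⊆ᵇ (λ j → M (suc j) ∧ N j) ∧ isClique G⁻ S)
    reorder S = begin
      (M zero ∧ S ⊆ᵇ (M ∘ suc)) ∧ isClique G (true ∷ S)
        ≡⟨ cong (_ ∧_) (isClique-true∷ G S) ⟩
      (M zero ∧ S ⊆ᵇ (M ∘ suc)) ∧ (S ⊆ᵇ N ∧ isClique G⁻ S)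
        ≡⟨ ∧-assoc (M zero) _ _ ⟩
      M zero ∧ (S ⊆ᵇ (M ∘ suc) ∧ (S ⊆ᵇ N ∧ isClique G⁻ S))
        ≡⟨ cong (M zero ∧_) (sym (∧-assoc (S ⊆ᵇ (M ∘ suc)) (S ⊆ᵇ N) (isClique G⁻ S))) ⟩
      M zero ∧ ((S ⊆ᵇ (M ∘ suc) ∧ S ⊆ᵇ N) ∧ isClique G⁻ S)
        ≡⟨ cong (λ b → M zero ∧ (b ∧ isClique G⁻ S)) (sym (⊆ᵇ-∧ S (M ∘ suc) N)) ⟩
      M zero ∧ (S ⊆ᵇ (λ j → M (suc j) ∧ N j) ∧ isClique G⁻ S)
        ∎
  without-zero : count (λ S → (false ∷ S) ⊆ᵇ M ∧ isClique G (false ∷ S)) (allSubsets n)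
               ≡ cliquesWithin G⁻ (M ∘ suc)
  without-zero = count-cong (λ S → cong (S ⊆ᵇ (M ∘ suc) ∧_) (isClique-false∷ G S)) (allSubsets n)

cliquesWithin-none : ∀ {n} (G : Graph n) → cliquesWithin G (λ _ → false) ≡ 1
cliquesWithin-none {zero} G = refl
cliquesWithin-none {suc n} G = trans (cliquesWithin-suc G (λ _ → false)) (cliquesWithin-none (tailGraph G))

cliqueCount-suc : ∀ {n} (G : Graph (suc n)) →
  cliqueCount G ≡ cliquesWithin (tailGraph G) (firstNeighbours G) + cliqueCount (tailGraph G)
cliqueCount-suc G =
  trans (cliqueCount-as-cliquesWithin G)
        (trans (cliquesWithin-suc G (λ _ → true))
               (cong (_+_ (cliquesWithin (tailGraph G) (firstNeighbours G)))
                     (sym (cliqueCount-as-cliquesWithin (tailGraph G)))))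

-- Complete graphs

[1+n]C2≡n+nC2 : ∀ n → suc n C 2 ≡ n + n C 2
[1+n]C2≡n+nC2 n = trans (sym (nCk+nC[k+1]≡[n+1]C[k+1] n 1)) (cong (_+ n C 2) (nC1≡n n))

complete : ∀ n → Graph n
complete zero = record { adj = λ () ; sym = λ () ; irrefl = λ () }
complete (suc n) = extend (complete n) (λ _ → true)

complete-degenerate : ∀ {d n} → n ≤ suc d → Degenerate d (complete n)
complete-degenerate {d} {zero} _ = degenerate-empty d (complete zero)
complete-degenerate {d} {suc n} (s≤s n≤d) =
  degenerate-suc (complete (suc n)) (complete-degenerate (m≤n⇒m≤1+n n≤d))
                 (≤-trans (≤-reflexive (countFin-true n)) n≤d)

edgeCount-complete : ∀ n → edgeCount (complete n) ≡ n C 2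
edgeCount-complete zero = refl
edgeCount-complete (suc n) = begin
  edgeCount (complete (suc n))                          ≡⟨ edgeCount-suc (complete (suc n)) ⟩
  countFin {n} (λ _ → true) + edgeCount (complete n)    ≡⟨ cong₂ _+_ (countFin-true n) (edgeCount-complete n) ⟩
  n + n C 2                                             ≡⟨ sym ([1+n]C2≡n+nC2 n) ⟩
  suc n C 2                                             ∎

cliquesWithin-complete : ∀ n (M : Fin n → Bool) → cliquesWithin (complete n) M ≡ 2 ^ countFin M
cliquesWithin-complete zero M = refl
cliquesWithin-complete (suc n) M = trans (cliquesWithin-suc (complete (suc n)) M) (split (M zero))
  where
  IH : cliquesWithin (complete n) (M ∘ suc) ≡ 2 ^ countFin (M ∘ suc)
  IH = cliquesWithin-complete n (M ∘ suc)
  split : ∀ b → (if b then cliquesWithin (complete n) (λ j → M (suc j) ∧ true) else 0)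
                  + cliquesWithin (complete n) (M ∘ suc)
              ≡ 2 ^ ((if b then 1 else 0) + countFin (M ∘ suc))
  split false = IH
  split true = cong₂ _+_ (trans (cliquesWithin-cong (complete n) (∧-identityʳ ∘ M ∘ suc)) IH)
                         (trans IH (sym (+-identityʳ _)))

cliqueCount-complete : ∀ n → cliqueCount (complete n) ≡ 2 ^ n
cliqueCount-complete n =
  trans (cliqueCount-as-cliquesWithin (complete n))
        (trans (cliquesWithin-complete n (λ _ → true)) (cong (2 ^_) (countFin-true n)))

-- Complete split graphs

-- The d clique vertices come last in Fin (k + d): each independent vertex is added as vertex zero.
cliquePart : ∀ k {d} → Fin (k + d) → Bool
cliquePart zero _ = true
cliquePart (suc k) zero = false
cliquePart (suc k) (suc j) = cliquePart k j

countFin-cliquePart : ∀ k d → countFin (cliquePart k {d}) ≡ d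
countFin-cliquePart zero d = countFin-true d
countFin-cliquePart (suc k) d = countFin-cliquePart k d

completeSplit : ∀ k d → Graph (k + d)
completeSplit zero d = complete d
completeSplit (suc k) d = extend (completeSplit k d) (cliquePart k)

completeSplit-degenerate : ∀ k d → Degenerate d (completeSplit k d)
completeSplit-degenerate zero d = complete-degenerate (n≤1+n d)
completeSplit-degenerate (suc k) d =
  degenerate-suc (completeSplit (suc k) d) (completeSplit-degenerate k d) (≤-reflexive (countFin-cliquePart k d))

edgeCount-completeSplit : ∀ k d → edgeCount (completeSplit k d) ≡ k * d + d C 2
edgeCount-completeSplit zero d = edgeCount-complete d
edgeCount-completeSplit (suc k) d = begin
  edgeCount (completeSplit (suc k) d)
    ≡⟨ edgeCount-suc (completeSplit (suc k) d) ⟩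
  countFin (cliquePart k) + edgeCount (completeSplit k d)
    ≡⟨ cong₂ _+_ (countFin-cliquePart k d) (edgeCount-completeSplit k d) ⟩
  d + (k * d + d C 2)
    ≡⟨ sym (+-assoc d (k * d) (d C 2)) ⟩
  suc k * d + d C 2
    ∎

cliquesWithin-cliquePart : ∀ k d → cliquesWithin (completeSplit k d) (cliquePart k) ≡ 2 ^ d
cliquesWithin-cliquePart zero d = trans (cliquesWithin-complete d (λ _ → true)) (cong (2 ^_) (countFin-true d))
cliquesWithin-cliquePart (suc k) d =
  trans (cliquesWithin-suc (completeSplit (suc k) d) (cliquePart (suc k))) (cliquesWithin-cliquePart k d)

cliqueCount-completeSplit : ∀ k d → cliqueCount (completeSplit k d) ≡ suc k * 2 ^ d
cliqueCount-completeSplit zero d = trans (cliqueCount-complete d) (sym (+-identityʳ (2 ^ d)))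
cliqueCount-completeSplit (suc k) d =
  trans (cliqueCount-suc (completeSplit (suc k) d))
        (cong₂ _+_ (cliquesWithin-cliquePart k d) (cliqueCount-completeSplit k d))

-- Adding isolated vertices

withIsolated : ∀ {n} r → Graph n → Graph (r + n)
withIsolated zero G = G
withIsolated (suc r) G = extend (withIsolated r G) (λ _ → false)

withIsolated-degenerate : ∀ {n d} r (G : Graph n) → Degenerate d G → Degenerate d (withIsolated r G)
withIsolated-degenerate zero G G-degenerate = G-degenerate
withIsolated-degenerate {n} (suc r) G G-degenerate =
  degenerate-suc (withIsolated (suc r) G) (withIsolated-degenerate r G G-degenerate)
                 (≤-trans (≤-reflexive (countFin-false (r + n))) z≤n)

edgeCount-withIsolated : ∀ {n} r (G : Graph n) → edgeCount (withIsolated r G) ≡ edgeCount G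
edgeCount-withIsolated zero G = refl
edgeCount-withIsolated {n} (suc r) G =
  trans (edgeCount-suc (withIsolated (suc r) G))
        (cong₂ _+_ (countFin-false (r + n)) (edgeCount-withIsolated r G))

cliqueCount-withIsolated : ∀ {n} r (G : Graph n) → cliqueCount (withIsolated r G) ≡ r + cliqueCount G
cliqueCount-withIsolated zero G = refl
cliqueCount-withIsolated (suc r) G =
  trans (cliqueCount-suc (withIsolated (suc r) G))
        (cong₂ _+_ (cliquesWithin-none (withIsolated r G)) (cliqueCount-withIsolated r G))

2*nC2+n≡n*n : ∀ n → 2 * (n C 2) + n ≡ n * n
2*nC2+n≡n*n zero = refl
2*nC2+n≡n*n (suc n) = begin
  2 * (suc n C 2) + suc n  ≡⟨ cong (λ c → 2 * c + suc n) ([1+n]C2≡n+nC2 n) ⟩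
  2 * (n + n C 2) + suc n  ≡⟨ expand n (n C 2) ⟩
  2 * (n C 2) + n + 2 * n + 1 ≡⟨ cong (λ x → x + 2 * n + 1) (2*nC2+n≡n*n n) ⟩
  n * n + 2 * n + 1        ≡⟨ square n ⟩
  suc n * suc n            ∎
  where
  expand : ∀ n c → 2 * (n + c) + suc n ≡ 2 * c + n + 2 * n + 1
  expand = solve-∀
  square : ∀ n → n * n + 2 * n + 1 ≡ suc n * suc n
  square = solve-∀

choose-2-mod-odd : ∀ d .{{_ : NonZero d}} → d % 2 ≡ 1 → (d C 2) % d ≡ 0
choose-2-mod-odd d odd = begin
  (d C 2) % d      ≡⟨ cong (_% d) choose-2≡e*d ⟩
  (e * d) % d      ≡⟨ m*n%n≡0 e d ⟩
  0                ∎
  where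
  e : ℕ
  e = d / 2
  d≡1+e*2 : d ≡ 1 + e * 2
  d≡1+e*2 = trans (m≡m%n+[m/n]*n d 2) (cong (_+ e * 2) odd)
  rearrange : ∀ d e → d * (1 + e * 2) ≡ 2 * (e * d) + d
  rearrange = solve-∀
  choose-2≡e*d : d C 2 ≡ e * d
  choose-2≡e*d = *-cancelˡ-≡ (d C 2) (e * d) 2 (+-cancelʳ-≡ d _ _ (begin
    2 * (d C 2) + d  ≡⟨ 2*nC2+n≡n*n d ⟩
    d * d            ≡⟨ cong (d *_) d≡1+e*2 ⟩
    d * (1 + e * 2)  ≡⟨ rearrange d e ⟩
    2 * (e * d) + d  ∎))

choose-2-mod-even : ∀ d .{{_ : NonZero d}} → d % 2 ≡ 0 → (d C 2) % d ≡ d / 2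
choose-2-mod-even d {{d≢0}} even with d / 2 | trans (m≡m%n+[m/n]*n d 2) (cong (_+ d / 2 * 2) even)
... | zero | refl = ⊥-elim-irr (NonZero.nonZero d≢0)
... | suc e | refl = begin
  (d C 2) % d            ≡⟨ cong (_% d) choose-2≡ ⟩
  (suc e + e * d) % d    ≡⟨ [m+kn]%n≡m%n (suc e) e d ⟩
  suc e % d              ≡⟨ m<n⇒m%n≡m (m<m*n (suc e) 2 (s≤s (s≤s z≤n))) ⟩
  suc e                  ∎
  where
  rearrange : ∀ e → let d = suc e * 2 in d * d ≡ 2 * (suc e + e * d) + d
  rearrange = solve-∀
  choose-2≡ : d C 2 ≡ suc e + e * d
  choose-2≡ = *-cancelˡ-≡ (d C 2) _ 2 (+-cancelʳ-≡ d _ _ (trans (2*nC2+n≡n*n d) (rearrange e)))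

m%d≡c%d⇒m≡k*d+c : ∀ {m c d} .{{_ : NonZero d}} → c ≤ m → m % d ≡ c % d → ∃[ k ] m ≡ k * d + c
m%d≡c%d⇒m≡k*d+c {m} {c} {d} c≤m m≡c = k , (begin
  m                              ≡⟨ m≡m%n+[m/n]*n m d ⟩
  m % d + m / d * d              ≡⟨ cong₂ (λ r q → r + q * d) m≡c (sym (m∸n+n≡m (/-monoˡ-≤ d c≤m))) ⟩
  c % d + (k + c / d) * d        ≡⟨ rearrange (c % d) k (c / d) d ⟩
  k * d + (c % d + c / d * d)    ≡⟨ cong (_+_ (k * d)) (sym (m≡m%n+[m/n]*n c d)) ⟩
  k * d + c                      ∎)
  where
  k : ℕ
  k = m / d ∸ c / d
  rearrange : ∀ r k q d → r + (k + q) * d ≡ k * d + (r + q * d)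
  rearrange = solve-∀

isolated-vertices : ∀ d {k n} .{{_ : NonZero d}} →
  (k * d + d C 2) + suc d C 2 ≤ d * n → ∃[ r ] r + (k + d) ≡ n
isolated-vertices d {k} {n} bound =
  n ∸ (k + d) , m∸n+n≡m (*-cancelˡ-≤ d (subst (_≤ d * n) (sym d*[k+d]≡) bound))
  where
  distribute : ∀ d k → d * (k + d) ≡ k * d + d * d
  distribute = solve-∀
  regroup : ∀ k d c → k * d + (2 * c + d) ≡ (k * d + c) + (d + c)
  regroup = solve-∀
  d*[k+d]≡ : d * (k + d) ≡ (k * d + d C 2) + suc d C 2
  d*[k+d]≡ = begin
    d * (k + d)                    ≡⟨ distribute d k ⟩
    k * d + d * d                  ≡⟨ cong (_+_ (k * d)) (sym (2*nC2+n≡n*n d)) ⟩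
    k * d + (2 * (d C 2) + d)      ≡⟨ regroup k d (d C 2) ⟩
    (k * d + d C 2) + (d + d C 2)  ≡⟨ cong (_+_ (k * d + d C 2)) (sym ([1+n]C2≡n+nC2 d)) ⟩
    (k * d + d C 2) + suc d C 2    ∎

-- Both sides of the clique formula with the subtracted term moved across; with p = 2^d
-- and 2 · C(d,2) + d = d², the remaining content is a polynomial identity.
clique-identity : ∀ {d p k r c} → 2 * c + d ≡ d * d → 0 < p →
  2 * d * (r + suc k * p) + d * (d * p + (d + 1)) ≡ 2 * d * (r + (k + d)) + 2 * (p ∸ 1) * (k * d + c) + d * (3 * p)
clique-identity {d} {suc q} {k} {r} {c} choose-2 _ = +-cancelʳ-≡ (q * d) _ _ (begin
  2 * d * (r + suc k * suc q) + d * (d * suc q + (d + 1)) + q * d  ≡⟨ expand d q k r ⟩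
  P + q * (d * d)                                                  ≡⟨ cong (λ x → P + q * x) (sym choose-2) ⟩
  P + q * (2 * c + d)                                              ≡⟨ collect d q k r c ⟩
  2 * d * (r + (k + d)) + 2 * q * (k * d + c) + d * (3 * suc q) + q * d ∎)
  where
  P : ℕ
  P = 2 * d * (r + (k + d)) + 2 * q * k * d + d * (3 * suc q)
  expand : ∀ d q k r → 2 * d * (r + suc k * suc q) + d * (d * suc q + (d + 1)) + q * d
                     ≡ 2 * d * (r + (k + d)) + 2 * q * k * d + d * (3 * suc q) + q * (d * d)
  expand = solve-∀
  collect : ∀ d q k r c → 2 * d * (r + (k + d)) + 2 * q * k * d + d * (3 * suc q) + q * (2 * c + d)
                        ≡ 2 * d * (r + (k + d)) + 2 * q * (k * d + c) + d * (3 * suc q) + q * d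
  collect = solve-∀

ℕ-identity⇒ℤ : ∀ {a x y d p} → a + d * (d * p + (d + 1)) ≡ x + y + d * (3 * p) →
  + a ≡ (+ x ℤ.+ + y) - + d ℤ.* ((+ d - + 3) ℤ.* + p ℤ.+ + (d + 1))
ℕ-identity⇒ℤ {a} {x} {y} {d} {p} eq = begin
  + a                                            ≡⟨ add-subtract (+ a) U ⟩
  (+ a ℤ.+ U) - U                                ≡⟨ cong (_- U) lifted ⟩
  (+ x ℤ.+ + y ℤ.+ V) - U                        ≡⟨ collect (+ x) (+ y) (+ d) (+ p) (+ (d + 1)) ⟩
  (+ x ℤ.+ + y) - + d ℤ.* ((+ d - + 3) ℤ.* + p ℤ.+ + (d + 1)) ∎
  where
  U V : ℤ
  U = + d ℤ.* (+ d ℤ.* + p ℤ.+ + (d + 1))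
  V = + d ℤ.* (+ 3 ℤ.* + p)
  add-subtract : ∀ A B → A ≡ (A ℤ.+ B) - B
  add-subtract = ℤ-Solver.solve-∀
  collect : ∀ X Y D P E → (X ℤ.+ Y ℤ.+ D ℤ.* (+ 3 ℤ.* P)) - D ℤ.* (D ℤ.* P ℤ.+ E)
                        ≡ (X ℤ.+ Y) - D ℤ.* ((D - + 3) ℤ.* P ℤ.+ E)
  collect = ℤ-Solver.solve-∀
  lifted : + a ℤ.+ U ≡ + x ℤ.+ + y ℤ.+ V
  lifted = begin
    + a ℤ.+ + d ℤ.* (+ d ℤ.* + p ℤ.+ + (d + 1))
      ≡⟨ cong (λ z → + a ℤ.+ + d ℤ.* (z ℤ.+ + (d + 1))) (sym (pos-* d p)) ⟩
    + a ℤ.+ + d ℤ.* (+ (d * p) ℤ.+ + (d + 1))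
      ≡⟨ cong (λ z → + a ℤ.+ + d ℤ.* z) (sym (pos-+ (d * p) (d + 1))) ⟩
    + a ℤ.+ + d ℤ.* + (d * p + (d + 1))
      ≡⟨ cong (ℤ._+_ (+ a)) (sym (pos-* d _)) ⟩
    + a ℤ.+ + (d * (d * p + (d + 1)))
      ≡⟨ sym (pos-+ a _) ⟩
    + (a + d * (d * p + (d + 1)))
      ≡⟨ cong +_ eq ⟩
    + (x + y + d * (3 * p))
      ≡⟨ pos-+ (x + y) _ ⟩
    + (x + y) ℤ.+ + (d * (3 * p))
      ≡⟨ cong₂ ℤ._+_ (pos-+ x y) (trans (pos-* d _) (cong (ℤ._*_ (+ d)) (pos-* 3 p))) ⟩
    + x ℤ.+ + y ℤ.+ + d ℤ.* (+ 3 ℤ.* + p)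
      ∎

clique-formula : ∀ d k r →
  + (2 * d * (r + suc k * 2 ^ d))
    ≡ (+ (2 * d * (r + (k + d))) ℤ.+ + (2 * (2 ^ d ∸ 1) * (k * d + d C 2)))
      - + d ℤ.* ((+ d - + 3) ℤ.* + (2 ^ d) ℤ.+ + (d + 1))
clique-formula d k r =
  ℕ-identity⇒ℤ {x = 2 * d * (r + (k + d))} {2 * (2 ^ d ∸ 1) * (k * d + d C 2)} {d} {2 ^ d}
    (clique-identity {d} {2 ^ d} {k} {r} {d C 2} (2*nC2+n≡n*n d) (m^n>0 2 d))

%2-cases : ∀ d → d % 2 ≡ 0 ⊎ d % 2 ≡ 1
%2-cases d with d % 2 | m%n<n d 2
... | 0 | _ = inj₁ refl
... | 1 | _ = inj₂ refl
... | suc (suc _) | s≤s (s≤s ())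

m%d≡dC2%d : ∀ d .{{_ : NonZero d}} m →
  (d % 2 ≡ 1 → m % d ≡ 0) → (d % 2 ≡ 0 → m % d ≡ d / 2) → m % d ≡ (d C 2) % d
m%d≡dC2%d d m odd⇒ even⇒ with %2-cases d
... | inj₁ even = trans (even⇒ even) (sym (choose-2-mod-even d even))
... | inj₂ odd = trans (odd⇒ odd) (sym (choose-2-mod-odd d odd))

proposition4 : (d : ℕ) → .{{_ : NonZero d}} → (n m : ℕ) →
    d C 2 ≤ m → m + (suc d) C 2 ≤ d * n →
    (d % 2 ≡ 1 → m % d ≡ 0) → (d % 2 ≡ 0 → m % d ≡ d / 2) →
    Σ (Graph n) λ G → Degenerate d G × edgeCount G ≡ m ×
      + (2 * d * cliqueCount G)
        ≡ ((+ (2 * d * n)) Data.Integer.+ (+ (2 * (2 ^ d ∸ 1) * m)))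
          - (+ d) Data.Integer.* (((+ d - + 3) Data.Integer.* (+ (2 ^ d))) Data.Integer.+ (+ (d + 1)))
proposition4 d n m C≤m m-bound odd⇒ even⇒
  with k , refl ← m%d≡c%d⇒m≡k*d+c C≤m (m%d≡dC2%d d m odd⇒ even⇒)
  with r , refl ← isolated-vertices d {k} m-bound
  = G , withIsolated-degenerate r _ (completeSplit-degenerate k d)
      , trans (edgeCount-withIsolated r _) (edgeCount-completeSplit k d)
      , trans (cong (λ c → + (2 * d * c)) cliques) (clique-formula d k r)
  where
  G : Graph (r + (k + d))
  G = withIsolated r (completeSplit k d)
  cliques : cliqueCount G ≡ r + suc k * 2 ^ d
  cliques = trans (cliqueCount-withIsolated r _) (cong (_+_ r) (cliqueCount-completeSplit k d))
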